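{- For every $\lambda_\oplus$-term $M$, $\mathcal T(\mathrm{eBT}(M))=\{s\in\mathcal T(M)\mid s\text{ is normal}\}$.
   Context: $\lambda_\oplus$-terms: $M,N,P,Q ::= x\mid\lambda x.M\mid MN\mid M\oplus N$ up to renaming of bound variables; approximants add a constant $\bot$. $\lambda\vec x$ is a possibly empty sequence of abstractions. $\mathrm{eBT}(M\oplus N)=\mathrm{eBT}(M)\oplus\mathrm{eBT}(N)$, $\mathrm{eBT}(\lambda\vec x.xQ_1\cdots Q_k)=\lambda\vec x.x\,\mathrm{eBT}(Q_1)\cdots\mathrm{eBT}(Q_k)$ ($k\ge0$), and $\mathrm{eBT}(M)=\bot$ in all other cases. Resource terms and monomials: $s,t ::= x\mid\lambda x.s\mid\langle s\rangle\bar t\mid s\oplus\bullet\mid\bullet\oplus s$, $\bar t::=[t_1,\dots,t_n]$ (finite multisets). The Taylor support of approximants: $\mathcal T(\bot)=\emptyset$, $\mathcal T(x)=\{x\}$, $\mathcal T(\lambda x.N)=\{\lambda x.t\mid t\in\mathcal T(N)\}$, $\mathcal T(PQ)=\{\langle s\rangle[t_1,\dots,t_n]\mid n\ge0,\ s\in\mathcal T(P),\ t_i\in\mathcal T(Q)\}$, $\mathcal T(P\oplus Q)=\{s\oplus\bullet\mid s\in\mathcal T(P)\}\cup\{\bullet\oplus t\mid t\in\mathcal T(Q)\}$. A resource term is normal if it contains no subterm (redex) of one of the forms $\langle\lambda x.s\rangle\bar t$, $\langle s\oplus\bullet\rangle\bar t$, $\langle\bullet\oplus s\rangle\bar t$,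 $\lambda x.(s\oplus\bullet)$, $\lambda x.(\bullet\oplus s)$. -}

module Defs where

open import Data.Nat using (ℕ)
open import Data.List using (List)
open import Data.List.Relation.Unary.All using (All)
open import Data.List.Relation.Unary.Any using (Any)
open import Data.Maybe using (Maybe; just; nothing; map; fromMaybe)
open import Data.Product using (_×_)
open import Relation.Nullary using (¬_)

-- λ⊕-terms, de Bruijn indices (terms up to renaming of bound variables)
data Term : Set where
  var : ℕ → Term
  lam : Term → Term
  app : Term → Term → Term
  _⊕_ : Term → Term → Term

data Approx : Set where
  ⊥A   : Approx
  varA : ℕ → Approx
  lamA : Approx → Approx
  appA : Approx → Approx → Approx
  _⊕A_ : Approx → Approx → Approx

embed : Term → Approx
embed (var x)   = varA x
embed (lam M)   = lamA (embed M)
embed (app M N) = appA (embed M) (embed N)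
embed (M ⊕ N)   = embed M ⊕A embed N

-- eBT.  headApp M = just (x eBT(Q₁)…eBT(Qₖ)) if M = x Q₁ … Qₖ, else nothing;
-- headForm M = just (λx⃗. x eBT(Q₁)…eBT(Qₖ)) if M = λx⃗. x Q₁ … Qₖ, else nothing.
mutual
  eBT : Term → Approx
  eBT (M ⊕ N) = eBT M ⊕A eBT N
  eBT (var x)   = fromMaybe ⊥A (headForm (var x))
  eBT (lam M)   = fromMaybe ⊥A (headForm (lam M))
  eBT (app M N) = fromMaybe ⊥A (headForm (app M N))

  headForm : Term → Maybe Approx
  headForm (lam M) = map lamA (headForm M)
  headForm M       = headApp M

  headApp : Term → Maybe Approx
  headApp (var x)   = just (varA x)
  headApp (app P Q) = map (λ a → appA a (eBT Q)) (headApp P)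
  headApp (lam M)   = nothing
  headApp (M ⊕ N)   = nothing

-- resource terms; finite multisets [t₁,…,tₙ] are represented by lists
-- (all predicates below are invariant under permutation of the list)
data RTerm : Set where
  rvar : ℕ → RTerm
  rlam : RTerm → RTerm
  rapp : RTerm → List RTerm → RTerm
  _⊕• : RTerm → RTerm
  •⊕_ : RTerm → RTerm

data _∈T_ : RTerm → Approx → Set where
  tvar  : ∀ {x} → rvar x ∈T varA x
  tlam  : ∀ {s N} → s ∈T N → rlam s ∈T lamA N
  tapp  : ∀ {s ts P Q} → s ∈T P → All (_∈T Q) ts → rapp s ts ∈T appA P Q
  tsumL : ∀ {s P Q} → s ∈T P → (s ⊕•) ∈T (P ⊕A Q)
  tsumR : ∀ {t P Q} → t ∈T Q → (•⊕ t) ∈T (P ⊕A Q)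

_∈TT_ : RTerm → Term → Set
s ∈TT M = s ∈T embed M

data Redex : RTerm → Set where
  rβ    : ∀ {s ts} → Redex (rapp (rlam s) ts)
  rappL : ∀ {s ts} → Redex (rapp (s ⊕•) ts)
  rappR : ∀ {s ts} → Redex (rapp (•⊕ s) ts)
  rlamL : ∀ {s} → Redex (rlam (s ⊕•))
  rlamR : ∀ {s} → Redex (rlam (•⊕ s))

data HasRedex : RTerm → Set where
  here   : ∀ {s} → Redex s → HasRedex s
  inLam  : ∀ {s} → HasRedex s → HasRedex (rlam s)
  inFun  : ∀ {s ts} → HasRedex s → HasRedex (rapp s ts)
  inArg  : ∀ {s ts} → Any HasRedex ts → HasRedex (rapp s ts)
  inSumL : ∀ {s} → HasRedex s → HasRedex (s ⊕•)
  inSumR : ∀ {s} → HasRedex s → HasRedex (•⊕ s)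

Normal : RTerm → Set
Normal s = ¬ HasRedex s

module Submission where

-- We first characterise normality of resource terms
-- constructor by constructor: an abstraction is normal iff its body is
-- normal and not a sum, an application iff its head is a normal neutral
-- term (a variable or an application) and its arguments are normal.  We
-- then prove, by one simultaneous induction on M, the matching statement
-- for each of the three functions:
--   𝒯(headApp M)  = normal neutral terms of 𝒯(M),
--   𝒯(headForm M) = normal non-sum terms of 𝒯(M),
--   𝒯(eBT M)      = normal terms of 𝒯(M),
-- each direction separately (soundness ⊆ and completeness ⊇).  The partial
-- approximants returned by headApp/headForm are handled by extending 𝒯 to
-- Maybe Approx, with 𝒯(nothing) = ∅ = 𝒯(⊥).

open import Defs
open import Data.Empty using (⊥)
open import Data.List.Relation.Unary.All as All using (All)
open import Data.List.Relation.Unary.All.Properties using (¬Any⇒All¬; All¬⇒¬Any)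
open import Data.Maybe using (Maybe; just; nothing; map; fromMaybe)
open import Data.Product using (_×_; _,_; ∃; ∃₂)
open import Function.Bundles using (_⇔_; mk⇔; module Equivalence)
open import Relation.Binary.PropositionalEquality using (_≡_; refl)

-- Resource terms that may head a normal application: no β-redex and no
-- sum in head position.
data Neutral : RTerm → Set where
  nvar : ∀ {x} → Neutral (rvar x)
  napp : ∀ {s ts} → Neutral (rapp s ts)

-- Resource terms that may be the body of a normal abstraction.
data NonSum : RTerm → Set where
  nsvar : ∀ {x} → NonSum (rvar x)
  nslam : ∀ {s} → NonSum (rlam s)
  nsapp : ∀ {s ts} → NonSum (rapp s ts)

neutral⇒nonSum : ∀ {s} → Neutral s → NonSum s
neutral⇒nonSum nvar = nsvar
neutral⇒nonSum napp = nsapp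

normal-var : ∀ {x} → Normal (rvar x)
normal-var (here ())

normal-sumL : ∀ {s} → Normal (s ⊕•) ⇔ Normal s
normal-sumL = mk⇔ (λ n r → n (inSumL r)) λ { n (here ()) ; n (inSumL r) → n r }

normal-sumR : ∀ {s} → Normal (•⊕ s) ⇔ Normal s
normal-sumR = mk⇔ (λ n r → n (inSumR r)) λ { n (here ()) ; n (inSumR r) → n r }

-- λx.s is normal iff s is normal and is not a sum (λx.(s ⊕ •) is a redex).
normal-lam : ∀ {s} → Normal (rlam s) ⇔ (Normal s × NonSum s)
normal-lam {s} = mk⇔ (λ n → (λ r → n (inLam r)) , nonSum s n) fromParts
  where
  nonSum : ∀ s → Normal (rlam s) → NonSum s
  nonSum (rvar x)   n = nsvar
  nonSum (rlam s)   n = nslam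
  nonSum (rapp s _) n = nsapp
  nonSum (s ⊕•)     n with () ← n (here rlamL)
  nonSum (•⊕ s)     n with () ← n (here rlamR)

  fromParts : Normal s × NonSum s → Normal (rlam s)
  fromParts (n , ()) (here rlamL)
  fromParts (n , ()) (here rlamR)
  fromParts (n , _)  (inLam r) = n r

normal-app : ∀ {s ts} → Normal (rapp s ts) ⇔ (Normal s × Neutral s × All Normal ts)
normal-app {s} {ts} =
  mk⇔ (λ n → (λ r → n (inFun r)) , neutral s n , ¬Any⇒All¬ ts (λ a → n (inArg a)))
      fromParts
  where
  neutral : ∀ s → Normal (rapp s ts) → Neutral s
  neutral (rvar x)   n = nvar
  neutral (rapp s _) n = napp
  neutral (rlam s)   n with () ← n (here rβ)
  neutral (s ⊕•)     n with () ← n (here rappL)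
  neutral (•⊕ s)     n with () ← n (here rappR)

  fromParts : Normal s × Neutral s × All Normal ts → Normal (rapp s ts)
  fromParts (n , () , _)  (here rβ)
  fromParts (n , () , _)  (here rappL)
  fromParts (n , () , _)  (here rappR)
  fromParts (n , _ , _)   (inFun r) = n r
  fromParts (_ , _ , ns)  (inArg a) = All¬⇒¬Any ns a

_∈M_ : RTerm → Maybe Approx → Set
s ∈M just a  = s ∈T a
s ∈M nothing = ⊥

-- Defaulting to ⊥ does not change the support, since 𝒯(⊥) = ∅.
∈-fromMaybe : ∀ m {s} → s ∈T fromMaybe ⊥A m ⇔ s ∈M m
∈-fromMaybe (just a) = mk⇔ (λ h → h) (λ h → h)
∈-fromMaybe nothing  = mk⇔ (λ ()) (λ ())

∈-mapLam⁻ : ∀ m {s} → s ∈M map lamA m → ∃ λ s′ → s ≡ rlam s′ × s′ ∈M m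
∈-mapLam⁻ (just a) (tlam h) = _ , refl , h

∈-mapLam⁺ : ∀ m {s} → s ∈M m → rlam s ∈M map lamA m
∈-mapLam⁺ (just a) h = tlam h

∈-mapApp⁻ : ∀ m B {s} → s ∈M map (λ a → appA a B) m →
            ∃₂ λ s′ ts → s ≡ rapp s′ ts × s′ ∈M m × All (_∈T B) ts
∈-mapApp⁻ (just a) B (tapp h hs) = _ , _ , refl , h , hs

∈-mapApp⁺ : ∀ m B {s ts} → s ∈M m → All (_∈T B) ts → rapp s ts ∈M map (λ a → appA a B) m
∈-mapApp⁺ (just a) B h hs = tapp h hs

neutralSpine : ∀ {M s} → s ∈TT M × Normal s × Neutral s → s ∈TT M × Normal s × NonSum s
neutralSpine (t , n , neu) = t , n , neutral⇒nonSum neu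

mutual
  headApp-sound : ∀ M {s} → s ∈M headApp M → s ∈TT M × Normal s × Neutral s
  headApp-sound (var x) tvar = tvar , normal-var , nvar
  headApp-sound (app P Q) h with ∈-mapApp⁻ (headApp P) (eBT Q) h
  ... | _ , _ , refl , hs , hts with headApp-sound P hs | args-sound Q hts
  ...   | t , n , neu | ts , nts =
    tapp t ts , Equivalence.from normal-app (n , neu , nts) , napp

  headApp-complete : ∀ M {s} → s ∈TT M → Normal s → Neutral s → s ∈M headApp M
  headApp-complete (var x) tvar n _ = tvar
  headApp-complete (app P Q) (tapp t ts) n _ with Equivalence.to normal-app n
  ... | ns , neu , nts =
    ∈-mapApp⁺ (headApp P) (eBT Q) (headApp-complete P t ns neu) (args-complete Q ts nts)
  headApp-complete (lam M)   (tlam _)  _ ()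
  headApp-complete (M ⊕ N)   (tsumL _) _ ()
  headApp-complete (M ⊕ N)   (tsumR _) _ ()

  headForm-sound : ∀ M {s} → s ∈M headForm M → s ∈TT M × Normal s × NonSum s
  headForm-sound (lam M) h with ∈-mapLam⁻ (headForm M) h
  ... | _ , refl , hs with headForm-sound M hs
  ...   | t , n , ns = tlam t , Equivalence.from normal-lam (n , ns) , nslam
  headForm-sound (var x)   h = neutralSpine (headApp-sound (var x) h)
  headForm-sound (app P Q) h = neutralSpine (headApp-sound (app P Q) h)

  headForm-complete : ∀ M {s} → s ∈TT M → Normal s → NonSum s → s ∈M headForm M
  headForm-complete (lam M) (tlam t) n _ with Equivalence.to normal-lam n
  ... | ns , nonSum = ∈-mapLam⁺ (headForm M) (headForm-complete M t ns nonSum)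
  headForm-complete (var x)   t@tvar       n _ = headApp-complete (var x) t n nvar
  headForm-complete (app P Q) t@(tapp _ _) n _ = headApp-complete (app P Q) t n napp
  headForm-complete (M ⊕ N) (tsumL _) _ ()
  headForm-complete (M ⊕ N) (tsumR _) _ ()

  eBT-sound : ∀ M {s} → s ∈T eBT M → s ∈TT M × Normal s
  eBT-sound (M ⊕ N) (tsumL h) with eBT-sound M h
  ... | t , n = tsumL t , Equivalence.from normal-sumL n
  eBT-sound (M ⊕ N) (tsumR h) with eBT-sound N h
  ... | t , n = tsumR t , Equivalence.from normal-sumR n
  eBT-sound (var x)   h = viaHeadForm (var x) h
  eBT-sound (lam M)   h = viaHeadForm (lam M) h
  eBT-sound (app P Q) h = viaHeadForm (app P Q) h

  eBT-complete : ∀ M {s} → s ∈TT M → Normal s → s ∈T eBT M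
  eBT-complete (M ⊕ N) (tsumL t) n = tsumL (eBT-complete M t (Equivalence.to normal-sumL n))
  eBT-complete (M ⊕ N) (tsumR t) n = tsumR (eBT-complete N t (Equivalence.to normal-sumR n))
  eBT-complete (var x)   t@tvar       n = intoHeadForm (var x) t n nsvar
  eBT-complete (lam M)   t@(tlam _)   n = intoHeadForm (lam M) t n nslam
  eBT-complete (app P Q) t@(tapp _ _) n = intoHeadForm (app P Q) t n nsapp

  viaHeadForm : ∀ M {s} → s ∈T fromMaybe ⊥A (headForm M) → s ∈TT M × Normal s
  viaHeadForm M h with headForm-sound M (Equivalence.to (∈-fromMaybe (headForm M)) h)
  ... | t , n , _ = t , n

  intoHeadForm : ∀ M {s} → s ∈TT M → Normal s → NonSum s → s ∈T fromMaybe ⊥A (headForm M)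
  intoHeadForm M t n ns = Equivalence.from (∈-fromMaybe (headForm M)) (headForm-complete M t n ns)

  args-sound : ∀ Q {ts} → All (_∈T eBT Q) ts → All (_∈TT Q) ts × All Normal ts
  args-sound Q hs = All.unzip (All.map (eBT-sound Q) hs)

  args-complete : ∀ Q {ts} → All (_∈TT Q) ts → All Normal ts → All (_∈T eBT Q) ts
  args-complete Q ts nts = All.zipWith (λ (t , n) → eBT-complete Q t n) (ts , nts)

lemma4p9 : (M : Term) → (s : RTerm) → (s ∈T eBT M) ⇔ ((s ∈TT M) × Normal s)
lemma4p9 M s = mk⇔ (eBT-sound M) (λ (t , n) → eBT-complete M t n)
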